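{- Let $n\ge3$. If an automorphism $T\in\mathbb{T}_n^2$ fixes all corners of the cube $n^2$ and fixes every point of the line $\ell=\{[i,0]: i\in[n]\}$, then $T$ is the identity.
   Context: Let $[n]=\{0,\dots,n-1\}$; the cube $n^2$ is $[n]^2$. A set of $n$ distinct points is a line if it can be ordered $(q^1,\dots,q^n)$ such that in each coordinate the sequence of values is strictly increasing, strictly decreasing or constant, with at least one coordinate non-constant. $\mathbb{T}_n^2$ is the group of permutations of $[n]^2$ mapping lines onto lines. A corner is a point with all coordinates in $\{0,n-1\}$. -}

module Defs where

open import Data.Nat using (ℕ)
open import Data.Fin using (Fin; toℕ; _<_)
open import Data.Product using (_×_; _,_; proj₁; proj₂; Σ; ∃)
open import Data.Sum using (_⊎_)
open import Relation.Nullary using (¬_)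
open import Relation.Binary.PropositionalEquality using (_≡_)
open import Function.Bundles using (_↔_; Inverse)

Point : ℕ → Set
Point n = Fin n × Fin n

StrictInc : ∀ {n} → (Fin n → Fin n) → Set
StrictInc f = ∀ i j → i < j → f i < f j

StrictDec : ∀ {n} → (Fin n → Fin n) → Set
StrictDec f = ∀ i j → i < j → f j < f i

Constant : ∀ {n} → (Fin n → Fin n) → Set
Constant f = ∀ i j → f i ≡ f j

GoodCoord : ∀ {n} → (Fin n → Fin n) → Set
GoodCoord f = StrictInc f ⊎ StrictDec f ⊎ Constant f

IsLineSeq : ∀ {n} → (Fin n → Point n) → Set
IsLineSeq q =
  (∀ i j → q i ≡ q j → i ≡ j)
  × GoodCoord (λ i → proj₁ (q i))
  × GoodCoord (λ i → proj₂ (q i))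
  × (¬ Constant (λ i → proj₁ (q i)) ⊎ ¬ Constant (λ i → proj₂ (q i)))

Subset : ℕ → Set₁
Subset n = Point n → Set

IsLine : ∀ {n} → Subset n → Set
IsLine {n} S = Σ (Fin n → Point n) λ q →
  IsLineSeq q × (∀ p → (S p → ∃ λ i → q i ≡ p) × ((∃ λ i → q i ≡ p) → S p))

image : ∀ {n} → (Point n → Point n) → Subset n → Subset n
image f S p = ∃ λ x → S x × f x ≡ p

IsAutomorphism : ∀ {n} → (Point n ↔ Point n) → Set₁
IsAutomorphism {n} T = ∀ (S : Subset n) → IsLine S → IsLine (image (Inverse.to T) S)

IsEnd : ∀ {n} → Fin n → Set
IsEnd {n} x = toℕ x ≡ 0 ⊎ toℕ x ≡ Data.Nat._∸_ n 1

IsCorner : ∀ {n} → Point n → Set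
IsCorner (a , b) = IsEnd a × IsEnd b

-- A strictly increasing self-map of Fin n is the identity and a
-- strictly decreasing one is `opposite` (i ↦ n-1-i).  Hence every line of
-- [n]² is contained in a column, a row, the diagonal (y = x) or the
-- antidiagonal (y = n-1-x); we call this its shape.  Since T maps lines to
-- lines, the T-image of any line has one of these four shapes, and the
-- known fixed points rule out all but one of them:
--   * the image of column x contains the fixed point (x,0), and it must be
--     column x again, so T preserves first coordinates;
--   * the image of the diagonal contains the fixed corners (0,0), (n-1,n-1),
--     so it is the diagonal, and T fixes the diagonal pointwise;
--   * the image of row y contains the fixed point (y,y) and must be row y,
--     so T preserves second coordinates as well.

module Submission where

open import Defs
open import Data.Nat using (ℕ; suc; _≤_; z≤n; s≤s)
import Data.Nat.Properties as ℕ
open import Data.Fin using (Fin; toℕ; fromℕ; opposite; inject₁; zero; suc)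
  renaming (_≤_ to _≤ᶠ_; _<_ to _<ᶠ_)
open import Data.Fin.Properties
  using (toℕ-fromℕ; toℕ-inject₁; toℕ<n; opposite-prop; opposite-involutive; ≤-antisym)
open import Data.Fin.Induction using (<-weakInduction)
open import Data.Product using (_,_; proj₁; proj₂; ∃)
open import Data.Sum using (inj₁; inj₂)
open import Data.Empty using (⊥-elim)
open import Relation.Nullary using (¬_)
open import Relation.Binary.PropositionalEquality
  using (_≡_; _≢_; refl; sym; trans; cong; cong₂; subst)
open import Function.Bundles using (_↔_; Inverse; Injection)
open import Function.Properties.Inverse using (↔⇒↣)

opposite-< : ∀ {n} {i j : Fin n} → i <ᶠ j → opposite j <ᶠ opposite i
opposite-< {suc n} {i} {j} i<j
  rewrite opposite-prop i | opposite-prop j = ℕ.∸-monoʳ-< (s≤s i<j) (toℕ<n j)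

-- A strictly increasing self-map of Fin n never moves a point down:
-- induction along 0 < 1 < … , each step gaining at least one.
strictInc-≥ : ∀ {n} {f : Fin n → Fin n} → StrictInc f → ∀ i → i ≤ᶠ f i
strictInc-≥ {suc n} {f} inc = <-weakInduction (λ i → i ≤ᶠ f i) z≤n step
  where
  step : ∀ i → inject₁ i ≤ᶠ f (inject₁ i) → suc i ≤ᶠ f (suc i)
  step i hyp = ℕ.≤-trans (s≤s (subst (_≤ toℕ (f (inject₁ i))) (toℕ-inject₁ i) hyp))
                         (inc (inject₁ i) (suc i) (s≤s (ℕ.≤-reflexive (toℕ-inject₁ i))))

-- Conjugating by `opposite` preserves strict increase; applied to the
-- previous lemma it shows that a strictly increasing map never moves up.
strictInc-≤ : ∀ {n} {f : Fin n → Fin n} → StrictInc f → ∀ i → f i ≤ᶠ i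
strictInc-≤ {f = f} inc i =
  ℕ.≮⇒≥ λ i<fi → ℕ.<⇒≱ (opposite-< i<fi)
    (subst (λ k → opposite i ≤ᶠ opposite (f k)) (opposite-involutive i)
      (strictInc-≥ conjugate (opposite i)))
  where
  conjugate : StrictInc (λ k → opposite (f (opposite k)))
  conjugate k l k<l = opposite-< (inc (opposite l) (opposite k) (opposite-< k<l))

strictInc⇒id : ∀ {n} {f : Fin n → Fin n} → StrictInc f → ∀ i → f i ≡ i
strictInc⇒id inc i = ≤-antisym (strictInc-≤ inc i) (strictInc-≥ inc i)

strictDec⇒opposite : ∀ {n} {f : Fin n → Fin n} → StrictDec f → ∀ i → f i ≡ opposite i
strictDec⇒opposite {f = f} dec i =
  trans (sym (opposite-involutive (f i))) (cong opposite (strictInc⇒id reversed i))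
  where
  reversed : StrictInc (λ k → opposite (f k))
  reversed k l k<l = opposite-< (dec k l k<l)

data CoordKind {n} (f : Fin n → Fin n) : Set where
  identity : (∀ i → f i ≡ i) → CoordKind f
  reversal : (∀ i → f i ≡ opposite i) → CoordKind f
  constant : Constant f → CoordKind f

coordKind : ∀ {n} {f : Fin n → Fin n} → GoodCoord f → CoordKind f
coordKind (inj₁ inc)        = identity (strictInc⇒id inc)
coordKind (inj₂ (inj₁ dec)) = reversal (strictDec⇒opposite dec)
coordKind (inj₂ (inj₂ c))   = constant c

OnDiagonal : ∀ {n} → Point n → Set
OnDiagonal (a , b) = b ≡ a

OnAntidiagonal : ∀ {n} → Point n → Set
OnAntidiagonal (a , b) = b ≡ opposite a

data Shape {n} (S : Subset n) : Set where
  vertical     : (∀ p q → S p → S q → proj₁ p ≡ proj₁ q) → Shape S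
  horizontal   : (∀ p q → S p → S q → proj₂ p ≡ proj₂ q) → Shape S
  diagonal     : (∀ p → S p → OnDiagonal p) → Shape S
  antidiagonal : (∀ p → S p → OnAntidiagonal p) → Shape S

shape-⊆ : ∀ {n} {S S′ : Subset n} → (∀ p → S p → S′ p) → Shape S′ → Shape S
shape-⊆ S⊆S′ (vertical h)     = vertical λ p q sp sq → h p q (S⊆S′ p sp) (S⊆S′ q sq)
shape-⊆ S⊆S′ (horizontal h)   = horizontal λ p q sp sq → h p q (S⊆S′ p sp) (S⊆S′ q sq)
shape-⊆ S⊆S′ (diagonal h)     = diagonal λ p sp → h p (S⊆S′ p sp)
shape-⊆ S⊆S′ (antidiagonal h) = antidiagonal λ p sp → h p (S⊆S′ p sp)

range : ∀ {n} → (Fin n → Point n) → Subset n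
range q p = ∃ λ i → q i ≡ p

coordKinds⇒shape : ∀ {n} {q : Fin n → Point n} →
  CoordKind (λ i → proj₁ (q i)) → CoordKind (λ i → proj₂ (q i)) → Shape (range q)
coordKinds⇒shape (constant c) _ = vertical λ { _ _ (i , refl) (j , refl) → c i j }
coordKinds⇒shape _ (constant c) = horizontal λ { _ _ (i , refl) (j , refl) → c i j }
coordKinds⇒shape (identity a) (identity b) =
  diagonal λ { _ (i , refl) → trans (b i) (sym (a i)) }
coordKinds⇒shape (reversal a) (reversal b) =
  diagonal λ { _ (i , refl) → trans (b i) (sym (a i)) }
coordKinds⇒shape (identity a) (reversal b) =
  antidiagonal λ { _ (i , refl) → trans (b i) (cong opposite (sym (a i))) }
coordKinds⇒shape (reversal a) (identity b) =
  antidiagonal λ { _ (i , refl) →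
    trans (b i) (trans (sym (opposite-involutive i)) (cong opposite (sym (a i)))) }

line-shape : ∀ {n} {S : Subset n} → IsLine S → Shape S
line-shape (q , (_ , good₁ , good₂ , _) , members) =
  shape-⊆ (λ p → proj₁ (members p)) (coordKinds⇒shape (coordKind good₁) (coordKind good₂))

range-line : ∀ {n} {q : Fin n → Point n} → IsLineSeq q → IsLine (range q)
range-line {q = q} seq = q , seq , λ p → (λ r → r) , (λ r → r)

module FixedCube (m : ℕ) (T : Point (suc (suc m)) ↔ Point (suc (suc m)))
  (automorphism : IsAutomorphism T)
  (corners-fixed : ∀ p → IsCorner p → Inverse.to T p ≡ p)
  (bottom-fixed : ∀ p → toℕ (proj₂ p) ≡ 0 → Inverse.to T p ≡ p) where

  N : ℕ
  N = suc (suc m)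

  to : Point N → Point N
  to = Inverse.to T

  first second last : Fin N
  first  = zero
  second = suc zero
  last   = fromℕ (suc m)

  first≢second : first ≢ second
  first≢second ()

  first≢last : first ≢ last
  first≢last ()

  opposite-last : opposite last ≡ first
  opposite-last = opposite-involutive first

  nonconstant : (f : Fin N → Fin N) → f first ≢ f second → ¬ Constant f
  nonconstant f f₀≢f₁ c = f₀≢f₁ (c first second)

  column row : Fin N → Subset N
  column x = range λ j → x , j
  row    y = range λ i → i , y

  diagonal-points : Subset N
  diagonal-points = range λ i → i , i

  column-line : ∀ x → IsLine (column x)
  column-line x = range-line
    ( (λ i j → cong proj₂) , inj₂ (inj₂ λ _ _ → refl) , inj₁ (λ _ _ i<j → i<j)
    , inj₂ (nonconstant (λ j → j) first≢second))

  row-line : ∀ y → IsLine (row y)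
  row-line y = range-line
    ( (λ i j → cong proj₁) , inj₁ (λ _ _ i<j → i<j) , inj₂ (inj₂ λ _ _ → refl)
    , inj₁ (nonconstant (λ i → i) first≢second))

  diagonal-line : IsLine diagonal-points
  diagonal-line = range-line
    ( (λ i j → cong proj₁) , inj₁ (λ _ _ i<j → i<j) , inj₁ (λ _ _ i<j → i<j)
    , inj₁ (nonconstant (λ i → i) first≢second))

  image-shape : ∀ {S} → IsLine S → Shape (image to S)
  image-shape {S} l = line-shape (automorphism S l)

  image-mem : ∀ {S : Subset N} {p} → S p → image to S (to p)
  image-mem {p = p} sp = p , sp , refl

  fixed-mem : ∀ {S : Subset N} {p} → to p ≡ p → S p → image to S p
  fixed-mem {p = p} fixed sp = p , sp , fixed

  injective : ∀ {p q} → to p ≡ to q → p ≡ q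
  injective = Injection.injective (↔⇒↣ T)

  lands-in-bottom : ∀ p → proj₂ (to p) ≡ first → to p ≡ p
  lands-in-bottom p e = injective (bottom-fixed (to p) (cong toℕ e))

  bottom : ∀ x → to (x , first) ≡ (x , first)
  bottom x = bottom-fixed (x , first) refl

  first-end : IsEnd first
  first-end = inj₁ refl

  last-end : IsEnd last
  last-end = inj₂ (toℕ-fromℕ (suc m))

  corner : ∀ {a b} → IsEnd a → IsEnd b → to (a , b) ≡ (a , b)
  corner ea eb = corners-fixed _ (ea , eb)

  -- Step 1: the image of column x, which contains the fixed point (x,0),
  -- is column x.
  column-preserved : ∀ x y → proj₁ (to (x , y)) ≡ x
  column-preserved x y with image-shape (column-line x)
  ... | vertical h = h _ _ (image-mem (y , refl)) (fixed-mem (bottom x) (first , refl))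
  ... | horizontal h = ⊥-elim (first≢second (sym (trans (sym (cong proj₂ moved)) lands)))
    where
    -- (x,1) would be sent into the bottom row, where only bottom points land
    lands : proj₂ (to (x , second)) ≡ first
    lands = h _ _ (image-mem (second , refl)) (fixed-mem (bottom x) (first , refl))
    moved : to (x , second) ≡ (x , second)
    moved = lands-in-bottom _ lands
  ... | diagonal h = ⊥-elim (first≢last (trans x-first (sym x-last)))
    where
    -- (x,0) on the diagonal forces x = 0, but the corner (0,n-1) is not on it
    x-first : first ≡ x
    x-first = h _ (fixed-mem (bottom x) (first , refl))
    x-last : last ≡ x
    x-last = h _ (fixed-mem (corner (subst IsEnd x-first first-end) last-end) (last , refl))
  ... | antidiagonal h = ⊥-elim (first≢last (sym last≡first))
    where
    -- (x,0) on the antidiagonal forces x = n-1, but the corner (n-1,n-1) is not on it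
    x-last : x ≡ last
    x-last = trans (sym (opposite-involutive x))
                   (cong opposite (sym (h _ (fixed-mem (bottom x) (first , refl)))))
    last-opp : last ≡ opposite x
    last-opp = h _ (fixed-mem (corner (subst IsEnd (sym x-last) last-end) last-end) (last , refl))
    last≡first : last ≡ first
    last≡first = trans last-opp (trans (cong opposite x-last) opposite-last)

  corner₀ : image to diagonal-points (first , first)
  corner₀ = fixed-mem (corner first-end first-end) (first , refl)

  corner₁ : image to diagonal-points (last , last)
  corner₁ = fixed-mem (corner last-end last-end) (last , refl)

  -- Step 2: the image of the diagonal is the diagonal, since it contains
  -- the fixed corners (0,0) and (n-1,n-1); so T fixes the diagonal pointwise.
  diagonal-fixed : ∀ y → to (y , y) ≡ (y , y)
  diagonal-fixed y with image-shape diagonal-line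
  ... | vertical h     = ⊥-elim (first≢last (h _ _ corner₀ corner₁))
  ... | horizontal h   = ⊥-elim (first≢last (h _ _ corner₀ corner₁))
  ... | antidiagonal h = ⊥-elim (first≢last (h _ corner₀))
  ... | diagonal h     = cong₂ _,_ (column-preserved y y)
                                   (trans (h _ (image-mem (y , refl))) (column-preserved y y))

  -- Step 3: the image of row y, which contains the fixed point (y,y), is row y.
  row-preserved : ∀ x y → proj₂ (to (x , y)) ≡ y
  row-preserved x y with image-shape (row-line y)
  ... | vertical h = ⊥-elim (first≢last (trans (sym (column-preserved first y))
          (trans (h _ _ (image-mem (first , refl)) (image-mem (last , refl)))
                 (column-preserved last y))))
  ... | horizontal h = h _ _ (image-mem (x , refl)) (fixed-mem (diagonal-fixed y) (y , refl))
  ... | diagonal h = trans on-diagonal (sym y≡x)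
    where
    on-diagonal : proj₂ (to (x , y)) ≡ x
    on-diagonal = trans (h _ (image-mem (x , refl))) (column-preserved x y)
    y≡x : y ≡ x
    y≡x = cong proj₂ (injective (trans (cong₂ _,_ (column-preserved x y) on-diagonal)
                                       (sym (diagonal-fixed x))))
  ... | antidiagonal h = ⊥-elim (first≢last (trans (sym y-first) y-last))
    where
    -- the row meets the antidiagonal image at (0,n-1) and at (n-1,0)
    image-on : ∀ i → to (i , y) ≡ (i , opposite i)
    image-on i = cong₂ _,_ (column-preserved i y)
      (trans (h _ (image-mem (i , refl))) (cong opposite (column-preserved i y)))
    y-last : y ≡ last
    y-last = cong proj₂ (injective (trans (image-on first) (sym (corner first-end last-end))))
    lands : proj₂ (to (last , y)) ≡ first
    lands = trans (cong proj₂ (image-on last)) opposite-last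
    y-first : y ≡ first
    y-first = trans (sym (cong proj₂ (lands-in-bottom (last , y) lands))) lands

  fixes-everything : ∀ p → to p ≡ p
  fixes-everything (x , y) = cong₂ _,_ (column-preserved x y) (row-preserved x y)

theorem5 : (n : ℕ) → 3 ≤ n → (T : Point n ↔ Point n) → IsAutomorphism T
    → (∀ p → IsCorner p → Inverse.to T p ≡ p)
    → (∀ p → toℕ (proj₂ p) ≡ 0 → Inverse.to T p ≡ p)
    → ∀ p → Inverse.to T p ≡ p
theorem5 (suc (suc (suc m))) (s≤s (s≤s (s≤s _))) T automorphism corners-fixed bottom-fixed =
  FixedCube.fixes-everything (suc m) T automorphism corners-fixed bottom-fixed
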